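{- Let $G$ be a finite simple connected graph on $n$ vertices. Then $G$ is a complete graph or a complete bipartite graph if and only if the following condition holds: for any four distinct vertices $u,v,w,x\in V(G)$, if $uv, vw, wx\in E(G)$ then $xu\in E(G)$.
   Context: Graphs are finite and simple. $uv\in E(G)$ means the vertices $u$ and $v$ are adjacent in $G$. -}

module Defs where

open import Data.Nat using (ℕ; suc)
open import Data.Fin using (Fin)
open import Data.Bool using (Bool)
open import Data.Product using (Σ; ∃; _×_; _,_)
open import Data.Empty using (⊥)
open import Relation.Nullary using (¬_; Dec)
open import Relation.Binary.PropositionalEquality using (_≡_; _≢_)
open import Level using (0ℓ)

record Graph (n : ℕ) : Set₁ where
  field
    Adj     : Fin n → Fin n → Set
    adj?    : ∀ u v → Dec (Adj u v)
    sym     : ∀ {u v} → Adj u v → Adj v u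
    irrefl  : ∀ {u} → ¬ Adj u u

open Graph public

data Walk {n : ℕ} (G : Graph n) : Fin n → Fin n → Set where
  nil  : ∀ {u} → Walk G u u
  cons : ∀ {u v w} → Adj G u v → Walk G v w → Walk G u w

Connected : ∀ {n} → Graph n → Set
Connected {n} G = ∀ (u v : Fin n) → Walk G u v

IsComplete : ∀ {n} → Graph n → Set
IsComplete {n} G = ∀ (u v : Fin n) → u ≢ v → Adj G u v

IsCompleteBipartite : ∀ {n} → Graph n → Set
IsCompleteBipartite {n} G =
  Σ (Fin n → Bool) λ side →
    (∃ λ a → ∃ λ b → side a ≢ side b) ×
    (∀ (u v : Fin n) → (Adj G u v → side u ≢ side v) × (side u ≢ side v → Adj G u v))

FourCycleCondition : ∀ {n} → Graph n → Set
FourCycleCondition {n} G =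
  ∀ (u v w x : Fin n) →
    u ≢ v → u ≢ w → u ≢ x → v ≢ w → v ≢ x → w ≢ x →
    Adj G u v → Adj G v w → Adj G w x → Adj G x u

-- With a triangle: the four-vertex condition puts every neighbour of a triangle
-- vertex a into a triangle with a, so the closed neighbourhood of a is closed
-- under edges; by connectivity a is universal, and so is every vertex (each lies
-- in a triangle through a).  Without a triangle: fix a root r; the condition makes
-- every vertex outside N(r) adjacent to all of N(r), and triangle-freeness leaves
-- N(r) and its complement as the two sides of a complete bipartite graph.
-- Conversely a path u v w x in a complete bipartite graph alternates sides, so
-- x and u lie on different sides.

module Submission where

open import Defs
open import Data.Nat using (ℕ; zero; suc)
open import Data.Bool using (Bool; not)
open import Data.Bool.Properties using (¬-not; not-involutive)
open import Data.Empty using (⊥-elim)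
open import Data.Fin using (Fin; _≟_) renaming (zero to fzero; suc to fsuc)
open import Data.Fin.Properties using (any?)
open import Data.Product using (∃; _×_; _,_; proj₁; proj₂)
open import Data.Sum using (_⊎_; inj₁; inj₂; [_,_])
open import Function.Base using (_∘_)
open import Function.Bundles using (_⇔_; mk⇔)
open import Relation.Nullary using (¬_; Dec; yes; no; does)
open import Relation.Nullary.Decidable using (_×-dec_)
open import Relation.Binary.PropositionalEquality
  using (_≡_; _≢_; refl; trans; cong; ≢-sym) renaming (sym to ≡-sym)

≢-≢⇒≡ : ∀ {a b c : Bool} → a ≢ b → b ≢ c → a ≡ c
≢-≢⇒≡ {c = c} a≢b b≢c =
  trans (¬-not a≢b) (trans (cong not (¬-not b≢c)) (not-involutive c))

module _ {n : ℕ} (G : Graph n) where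

  private
    _~_ : Fin n → Fin n → Set
    _~_ = Adj G

    ~-sym : ∀ {u v} → u ~ v → v ~ u
    ~-sym = Graph.sym G

  Adj⇒≢ : ∀ {u v} → u ~ v → u ≢ v
  Adj⇒≢ u~u refl = irrefl G u~u

  Adj⇒≢ʳ : ∀ {u v} → u ~ v → v ≢ u
  Adj⇒≢ʳ = ≢-sym ∘ Adj⇒≢

  walk-closed : ∀ {p} {P : Fin n → Set p} →
                (∀ {x y} → P x → x ~ y → P y) →
                ∀ {u v} → P u → Walk G u v → P v
  walk-closed step Pu nil          = Pu
  walk-closed step Pu (cons u~w w) = walk-closed step (step Pu u~w) w

  walk-first-edge : ∀ {u v} → u ≢ v → Walk G u v → ∃ (u ~_)
  walk-first-edge u≢u nil                  = ⊥-elim (u≢u refl)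
  walk-first-edge _   (cons {v = w} u~w _) = w , u~w

  Triangle : Fin n → Fin n → Fin n → Set
  Triangle a b c = a ~ b × b ~ c × c ~ a

  HasTriangle : Set
  HasTriangle = ∃ λ a → ∃ λ b → ∃ λ c → Triangle a b c

  hasTriangle? : Dec HasTriangle
  hasTriangle? = any? λ a → any? λ b → any? λ c →
    adj? G a b ×-dec adj? G b c ×-dec adj? G c a

  Universal : Fin n → Set
  Universal a = ∀ v → a ≢ v → a ~ v

  complete⇒fourCycle : IsComplete G → FourCycleCondition G
  complete⇒fourCycle complete u _ _ x _ _ u≢x _ _ _ _ _ _ = complete x u (≢-sym u≢x)

  completeBipartite⇒fourCycle : IsCompleteBipartite G → FourCycleCondition G
  completeBipartite⇒fourCycle (side , _ , adj⇔) u v w x _ _ _ _ _ _ u~v v~w w~x =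
    proj₂ (adj⇔ x u) λ sx≡su → proj₁ (adj⇔ w x) w~x (≡-sym (trans sx≡su su≡sw))
    where
    su≡sw : side u ≡ side w
    su≡sw = ≢-≢⇒≡ (proj₁ (adj⇔ u v) u~v) (proj₁ (adj⇔ v w) v~w)

  module _ (fc : FourCycleCondition G) where

    triangle-through-neighbour : ∀ {a b c v} → Triangle a b c → a ~ v →
                                 ∃ λ t → Triangle a v t
    triangle-through-neighbour {a} {b} {c} {v} (a~b , b~c , c~a) a~v with v ≟ b | v ≟ c
    ... | yes refl | _        = c , a~v , b~c , c~a
    ... | no _     | yes refl = b , a~v , ~-sym b~c , ~-sym a~b
    ... | no v≢b   | no v≢c   =
      c , a~v , ~-sym c~v , c~a
      where
      c~v : c ~ v
      c~v = fc v a b c (Adj⇒≢ʳ a~v) v≢b v≢c (Adj⇒≢ a~b) (Adj⇒≢ʳ c~a) (Adj⇒≢ b~c)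
               (~-sym a~v) a~b b~c

    closedNeighbourhood-closed : ∀ {a b c} → Triangle a b c →
                                 ∀ {x y} → x ≡ a ⊎ a ~ x → x ~ y → y ≡ a ⊎ a ~ y
    closedNeighbourhood-closed _   (inj₁ refl) x~y = inj₂ x~y
    closedNeighbourhood-closed {a} abc {x} {y} (inj₂ a~x) x~y
      with triangle-through-neighbour abc a~x
    ... | t , _ , x~t , t~a with y ≟ a | y ≟ t
    ... | yes y≡a | _        = inj₁ y≡a
    ... | no _    | yes refl = inj₂ (~-sym t~a)
    ... | no y≢a  | no y≢t   =
      inj₂ (fc y x t a (Adj⇒≢ʳ x~y) y≢t y≢a (Adj⇒≢ x~t) (Adj⇒≢ʳ a~x) (Adj⇒≢ t~a)
               (~-sym x~y) x~t t~a)

    triangle⇒universal : Connected G → ∀ {a b c} → Triangle a b c → Universal a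
    triangle⇒universal conn {a} abc v a≢v
      with walk-closed (closedNeighbourhood-closed abc) (inj₁ refl) (conn a v)
    ... | inj₁ v≡a = ⊥-elim (a≢v (≡-sym v≡a))
    ... | inj₂ a~v = a~v

    triangle⇒complete : Connected G → HasTriangle → IsComplete G
    triangle⇒complete conn (a , _ , _ , abc) u v u≢v with a ≟ u
    ... | yes refl = triangle⇒universal conn abc v u≢v
    ... | no a≢u   =
      let a~u = triangle⇒universal conn abc u a≢u
          t , _ , u~t , t~a = triangle-through-neighbour abc a~u
      in triangle⇒universal conn (u~t , t~a , a~u) v u≢v

    CoversNeighbourhood : Fin n → Fin n → Set
    CoversNeighbourhood r v = ∀ u → r ~ u → u ~ v

    neighbour⊎covers-closed : ∀ {r x y} → r ~ x ⊎ CoversNeighbourhood r x → x ~ y →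
                              r ~ y ⊎ CoversNeighbourhood r y
    neighbour⊎covers-closed {r} {x} {y} rx⊎cover x~y with adj? G r y | y ≟ r
    ... | yes r~y | _        = inj₁ r~y
    ... | no _    | yes refl = inj₂ λ _ r~u → ~-sym r~u
    ... | no r≁y  | no y≢r   = inj₂ (covers rx⊎cover)
      where
      covers : r ~ x ⊎ CoversNeighbourhood r x → CoversNeighbourhood r y
      covers (inj₁ r~x) u r~u with u ≟ x
      ... | yes refl = x~y
      ... | no u≢x   =
        fc y x r u (Adj⇒≢ʳ x~y) y≢r (λ { refl → r≁y r~u }) (Adj⇒≢ʳ r~x) (≢-sym u≢x)
           (Adj⇒≢ r~u) (~-sym x~y) (~-sym r~x) r~u
      -- This case is vacuous: the path y x u r would force r ~ y.
      covers (inj₂ cover) u r~u = ⊥-elim (r≁y r~y)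
        where
        u~x : u ~ x
        u~x = cover u r~u
        r~y : r ~ y
        r~y = fc y x u r (Adj⇒≢ʳ x~y) (λ { refl → r≁y r~u }) y≢r (Adj⇒≢ʳ u~x)
                 (λ { refl → r≁y x~y }) (Adj⇒≢ʳ r~u) (~-sym x~y) (~-sym u~x) (~-sym r~u)

    nonNeighbour⇒covers : Connected G → ∀ {r v} → ¬ r ~ v → CoversNeighbourhood r v
    nonNeighbour⇒covers conn {r} {v} r≁v
      with walk-closed neighbour⊎covers-closed (inj₂ λ _ r~u → ~-sym r~u) (conn r v)
    ... | inj₁ r~v  = ⊥-elim (r≁v r~v)
    ... | inj₂ cover = cover

    module _ (conn : Connected G) (triangleFree : ¬ HasTriangle) {r a : Fin n} (r~a : r ~ a) where

      side : Fin n → Bool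
      side v = does (adj? G r v)

      adjacent⇒sides-differ : ∀ u v → u ~ v → side u ≢ side v
      adjacent⇒sides-differ u v u~v with adj? G r u | adj? G r v
      ... | yes r~u | yes r~v = λ _ → triangleFree (r , u , v , r~u , u~v , ~-sym r~v)
      ... | yes _   | no _    = λ ()
      ... | no _    | yes _   = λ ()
      ... | no r≁u  | no r≁v  = λ _ → triangleFree
        (a , u , v , nonNeighbour⇒covers conn r≁u a r~a , u~v
           , ~-sym (nonNeighbour⇒covers conn r≁v a r~a))

      sides-differ⇒adjacent : ∀ u v → side u ≢ side v → u ~ v
      sides-differ⇒adjacent u v su≢sv with adj? G r u | adj? G r v
      ... | yes _   | yes _   = ⊥-elim (su≢sv refl)
      ... | no _    | no _    = ⊥-elim (su≢sv refl)
      ... | yes r~u | no r≁v  = nonNeighbour⇒covers conn r≁v u r~u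
      ... | no r≁u  | yes r~v = ~-sym (nonNeighbour⇒covers conn r≁u v r~v)

      root-side≢neighbour-side : side r ≢ side a
      root-side≢neighbour-side with adj? G r r | adj? G r a
      ... | yes r~r | _       = ⊥-elim (irrefl G r~r)
      ... | no _    | yes _   = λ ()
      ... | no _    | no r≁a  = ⊥-elim (r≁a r~a)

      triangleFree⇒completeBipartite : IsCompleteBipartite G
      triangleFree⇒completeBipartite =
        side , (r , a , root-side≢neighbour-side)
             , λ u v → adjacent⇒sides-differ u v , sides-differ⇒adjacent u v

fourCycle⇒complete⊎completeBipartite :
  ∀ n (G : Graph n) → Connected G → FourCycleCondition G →
  IsComplete G ⊎ IsCompleteBipartite G
fourCycle⇒complete⊎completeBipartite zero          _ _ _ = inj₁ λ ()
fourCycle⇒complete⊎completeBipartite (suc zero)    _ _ _ =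
  inj₁ λ { fzero fzero 0≢0 → ⊥-elim (0≢0 refl) }
fourCycle⇒complete⊎completeBipartite (suc (suc m)) G conn fc with hasTriangle? G
... | yes triangle = inj₁ (triangle⇒complete G fc conn triangle)
... | no triangleFree =
  let _ , r~a = walk-first-edge G (λ ()) (conn fzero (fsuc fzero))
  in inj₂ (triangleFree⇒completeBipartite G fc conn triangleFree r~a)

mainTheorem1 : (n : ℕ) (G : Graph n) → Connected G →
    ((IsComplete G ⊎ IsCompleteBipartite G) ⇔ FourCycleCondition G)
mainTheorem1 n G conn =
  mk⇔ [ complete⇒fourCycle G , completeBipartite⇒fourCycle G ]
      (fourCycle⇒complete⊎completeBipartite n G conn)
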